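{- Fix a set of sources $S = \{s_1, \dots, s_k\}$ and a set of sinks $R = \{r_1, \dots, r_k\}$ of $N(n,m)$. If $P,Q: S\to R$ are two families of highway paths in $N(n,m)$ (each consisting of $k$ paths whose sources are exactly $S$ and whose sinks are exactly $R$, with any pairing), then $\deg(P) \equiv \deg(Q) \pmod n$.
   Context: Fix integers $n\ge 2$, $m\ge1$; upper indices of variables $x_a^{(b)}$ ($1\le a\le m$) are read modulo $n$. Network $N(n,m)$: on a cylinder, draw $n$ horizontal wires (numbered $1,\dots,n$ from top to bottom, with the top and bottom of the picture identified) and $m$ vertical loops (numbered $1,\dots,m$ from left to right); each crossing is a vertex, and all edges are oriented rightward along wires and upward along loops (going up from wire $1$ leads to wire $n$). The crossing of wire $i$ and loop $a$ has weight $x_a^{(i+a-1)}$. The left end of wire $i$ is a source labeled $i$; the right end of wire $i$ is a sink labeled $i+m-1$ (mod $n$). A highway path is a directed path from a source to a sink that never uses two up edges in a row. Its weight $\mathrm{wt}(p)$ is the product of the weights of the vertices it enters and leaves by right edges. The weight of a family of paths is the product of the weights of its paths, and $\deg(P)$ is the degree of the monomial $\mathrm{wt}(P)$. -}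

module Defs where

-- Conventions (0-based): wire w : Fin n is wire (toℕ w + 1) of the paper,
-- loop a : Fin m is loop (toℕ a + 1).

open import Data.Nat using (ℕ; zero; suc; _+_)
open import Data.Fin using (Fin; toℕ)
open import Data.List using (List; []; _∷_; _++_; length; concat; tabulate)
open import Data.Product using (_×_; _,_)
open import Data.Sum using (_⊎_)
open import Data.Unit using (⊤)
open import Data.Empty using (⊥)
open import Data.Fin.Permutation using (Permutation′; _⟨$⟩ʳ_)
open import Relation.Binary.PropositionalEquality using (_≡_)

data Vertex (n m : ℕ) : Set where
  source : Fin n → Vertex n m
  sink   : Fin n → Vertex n m            -- right end of wire w (sink labeled w+m mod n)
  node   : Fin n → Fin m → Vertex n m

data Dir : Set where
  right : Dir
  up    : Dir

-- v is the wire directly above w on the cylinder (going up from wire 1 leads to wire n)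
IsAbove : {n : ℕ} → Fin n → Fin n → Set
IsAbove {n} v w = (suc (toℕ v) ≡ toℕ w) ⊎ ((toℕ w ≡ 0) × (suc (toℕ v) ≡ n))

data Edge {n m : ℕ} : Vertex n m → Vertex n m → Dir → Set where
  enter : (w : Fin n) (a : Fin m) → toℕ a ≡ 0 → Edge (source w) (node w a) right
  along : (w : Fin n) (a b : Fin m) → toℕ b ≡ suc (toℕ a) → Edge (node w a) (node w b) right
  exit  : (w : Fin n) (a : Fin m) → suc (toℕ a) ≡ m → Edge (node w a) (sink w) right
  climb : (w v : Fin n) (a : Fin m) → IsAbove v w → Edge (node w a) (node v a) up

data Walk {n m : ℕ} : Vertex n m → Vertex n m → Set where
  []   : {v : Vertex n m} → Walk v v
  step : {u v w : Vertex n m} {d : Dir} → Edge u v d → Walk v w → Walk u w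

bothUp : Dir → Dir → Set
bothUp up up = ⊥
bothUp _  _  = ⊤

Highway : {n m : ℕ} {u v : Vertex n m} → Walk u v → Set
Highway [] = ⊤
Highway (step e []) = ⊤
Highway (step {d = d} e (step {d = d'} f p)) = bothUp d d' × Highway (step f p)

-- a variable x_a^{(j)}: loop index a and upper index j (read modulo n)
Var : ℕ → Set
Var m = Fin m × ℕ

-- weight of the crossing of wire w and loop a: x_{a+1}^{((w+1)+(a+1)-1)}
vertexWeight : {n m : ℕ} → Vertex n m → List (Var m)
vertexWeight (node w a) = (a , toℕ w + toℕ a + 1) ∷ []
vertexWeight (source _) = []
vertexWeight (sink _) = []

-- a monomial is represented as the list of its variable factors (with multiplicity)
Monomial : ℕ → Set
Monomial m = List (Var m)

rightRight : {n m : ℕ} → Dir → Dir → Vertex n m → Monomial m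
rightRight right right v = vertexWeight v
rightRight _ _ _ = []

wt : {n m : ℕ} {u v : Vertex n m} → Walk u v → Monomial m
wt [] = []
wt (step e []) = []
wt (step {v = v} {d = d} e (step {d = d'} f p)) = rightRight d d' v ++ wt (step f p)

record Family (n m k : ℕ) (s r : Fin k → Fin n) : Set where
  field
    pairing : Permutation′ k
    path    : (i : Fin k) → Walk {n} {m} (source (s i)) (sink (r (pairing ⟨$⟩ʳ i)))
    highway : (i : Fin k) → Highway (path i)

familyWt : {n m k : ℕ} {s r : Fin k → Fin n} → Family n m k s r → Monomial m
familyWt {k = k} F = concat (tabulate {n = k} (λ i → wt (Family.path F i)))

deg : {n m k : ℕ} {s r : Fin k → Fin n} → Family n m k s r → ℕ
deg F = length (familyWt F)

module Submission where

-- A highway path p from source w to sink w' uses m + 1 right edges, and, since it never takes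
-- two up edges in a row and starts and ends with a right edge, every up edge separates two
-- right edges; hence deg(p) + #up(p) = m. Each up edge lowers the wire by one modulo n, so
-- #up(p) ≡ w − w' (mod n) and deg(p) ≡ m + w' − w. Summing over a family, the pairing only
-- permutes the sinks, so deg(P) ≡ k m + Σ r − Σ s (mod n) for every family P.

open import Defs
open import Data.Nat using (ℕ; _≤_; _%_; NonZero; zero; suc; _+_; _*_; _∸_)
open import Data.Nat.Properties
  using (+-suc; +-comm; +-assoc; +-identityʳ; *-suc; suc-injective; +-0-commutativeMonoid)
open import Data.Nat.DivMod using (%-distribˡ-+; n%n≡0; m*n%n≡0; [m+kn]%n≡m%n)
open import Data.Fin using (Fin; toℕ; zero; suc)
open import Data.List using (List; length; concat; tabulate)
open import Data.List.Properties using (length-++)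
open import Data.Product using (_,_)
open import Data.Sum using (inj₁; inj₂)
open import Data.Fin.Permutation using (_⟨$⟩ʳ_)
open import Function.Definitions using (Injective)
open import Relation.Binary.PropositionalEquality
open ≡-Reasoning
open import Algebra.Properties.CommutativeMonoid.Sum +-0-commutativeMonoid
  using (sum; ∑-distrib-+; sum-permute)

infix 4 _≡_[mod_]

_≡_[mod_] : ℕ → ℕ → (n : ℕ) → .{{NonZero n}} → Set
a ≡ b [mod n ] = a % n ≡ b % n

module _ (n : ℕ) .{{_ : NonZero n}} where

  +-congʳ-mod : ∀ {a b} c → a ≡ b [mod n ] → a + c ≡ b + c [mod n ]
  +-congʳ-mod {a} {b} c a≡b = begin
    (a + c) % n             ≡⟨ %-distribˡ-+ a c n ⟩
    (a % n + c % n) % n     ≡⟨ cong (λ t → (t + c % n) % n) a≡b ⟩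
    (b % n + c % n) % n     ≡⟨ %-distribˡ-+ b c n ⟨
    (b + c) % n             ∎

  +-cong-mod : ∀ {a b c d} → a ≡ b [mod n ] → c ≡ d [mod n ] → a + c ≡ b + d [mod n ]
  +-cong-mod {a} {b} {c} {d} a≡b c≡d = begin
    (a + c) % n  ≡⟨ +-congʳ-mod c a≡b ⟩
    (b + c) % n  ≡⟨ cong (_% n) (+-comm b c) ⟩
    (c + b) % n  ≡⟨ +-congʳ-mod b c≡d ⟩
    (d + b) % n  ≡⟨ cong (_% n) (+-comm d b) ⟩
    (b + d) % n  ∎

  -- Adding c (n − 1) to both sides turns + c into + c n, which vanishes modulo n.
  +-cancelʳ-mod : ∀ a b c → a + c ≡ b + c [mod n ] → a ≡ b [mod n ]
  +-cancelʳ-mod a b c a+c≡b+c = begin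
    a % n                      ≡⟨ [m+kn]%n≡m%n a c n ⟨
    (a + c * n) % n            ≡⟨ cong (_% n) (+c*n≡+c+c*pred a) ⟩
    (a + c + c * (n ∸ 1)) % n  ≡⟨ +-congʳ-mod (c * (n ∸ 1)) a+c≡b+c ⟩
    (b + c + c * (n ∸ 1)) % n  ≡⟨ cong (_% n) (+c*n≡+c+c*pred b) ⟨
    (b + c * n) % n            ≡⟨ [m+kn]%n≡m%n b c n ⟩
    b % n                      ∎
    where
    c*n≡c+c*pred : ∀ n .{{_ : NonZero n}} → c * n ≡ c + c * (n ∸ 1)
    c*n≡c+c*pred (suc n-1) = *-suc c n-1

    +c*n≡+c+c*pred : ∀ x → x + c * n ≡ x + c + c * (n ∸ 1)
    +c*n≡+c+c*pred x = trans (cong (x +_) (c*n≡c+c*pred n)) (sym (+-assoc x c _))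

  sum-cong-mod : ∀ {k} (f g : Fin k → ℕ) → (∀ i → f i ≡ g i [mod n ]) → sum f ≡ sum g [mod n ]
  sum-cong-mod {zero}  f g f≡g = refl
  sum-cong-mod {suc k} f g f≡g =
    +-cong-mod (f≡g zero) (sum-cong-mod (λ i → f (suc i)) (λ i → g (suc i)) (λ i → f≡g (suc i)))

length-concat-tabulate : ∀ {A : Set} {k} (g : Fin k → List A) →
                         length (concat (tabulate g)) ≡ sum (λ i → length (g i))
length-concat-tabulate {k = zero}  g = refl
length-concat-tabulate {k = suc k} g = trans (length-++ (g zero))
  (cong (length (g zero) +_) (length-concat-tabulate (λ i → g (suc i))))

module _ {n m : ℕ} where

  wire : Vertex n m → ℕ
  wire (source w) = toℕ w
  wire (sink w)   = toℕ w
  wire (node w _) = toℕ w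

  column : Vertex n m → ℕ
  column (source _) = 0
  column (sink _)   = suc m
  column (node _ a) = suc (toℕ a)

  upSteps : {x y : Vertex n m} → Walk x y → ℕ
  upSteps []                     = 0
  upSteps (step {d = right} _ p) = upSteps p
  upSteps (step {d = up}    _ p) = suc (upSteps p)

  rightSteps : {x y : Vertex n m} → Walk x y → ℕ
  rightSteps []                     = 0
  rightSteps (step {d = right} _ p) = suc (rightSteps p)
  rightSteps (step {d = up}    _ p) = rightSteps p

  isUp : Dir → ℕ
  isUp right = 0
  isUp up    = 1

  rightSteps+column≡suc-m : ∀ {x w'} (p : Walk x (sink w')) → rightSteps p + column x ≡ suc m
  rightSteps+column≡suc-m [] = refl
  rightSteps+column≡suc-m (step (enter _ _ a≡0) p) =
    trans (sym (+-suc (rightSteps p) 0)) (trans (cong (λ t → rightSteps p + suc t) (sym a≡0)) (rightSteps+column≡suc-m p))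
  rightSteps+column≡suc-m (step (along _ a b b≡1+a) p) =
    trans (sym (+-suc (rightSteps p) _)) (trans (cong (λ t → rightSteps p + suc t) (sym b≡1+a)) (rightSteps+column≡suc-m p))
  rightSteps+column≡suc-m (step (exit _ _ 1+a≡m) []) = cong suc 1+a≡m
  rightSteps+column≡suc-m (step (climb _ _ _ _) p) = rightSteps+column≡suc-m p

  -- Each variable of wt comes from two consecutive right edges; the highway condition puts every
  -- up edge between two right edges, except possibly a leading one, accounted for by isUp d.
  length-wt-highway : ∀ {x y w' d} (e : Edge x y d) (p : Walk y (sink w')) → Highway (step e p) →
                      suc (length (wt (step e p)) + upSteps (step e p)) ≡ rightSteps (step e p) + isUp d
  length-wt-highway {d = right} e [] _ = refl
  length-wt-highway {d = right} e (step {d = right} f@(along _ _ _ _) q) (_ , h) = cong suc (length-wt-highway f q h)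
  length-wt-highway {d = right} e (step {d = right} f@(exit _ _ _) q)    (_ , h) = cong suc (length-wt-highway f q h)
  length-wt-highway {d = right} e (step {d = up} f q) (_ , h) = begin
    suc (L + U)  ≡⟨ length-wt-highway f q h ⟩
    R + 1        ≡⟨ +-comm R 1 ⟩
    suc R        ≡⟨ +-identityʳ (suc R) ⟨
    suc R + 0    ∎
    where
    L U R : ℕ
    L = length (wt (step f q))
    U = upSteps (step f q)
    R = rightSteps (step f q)
  length-wt-highway {d = up} e (step {d = right} f q) (_ , h) = begin
    suc (L + suc U)  ≡⟨ cong suc (+-suc L U) ⟩
    suc (suc L + U)  ≡⟨ cong suc (length-wt-highway f q h) ⟩
    suc (R + 0)      ≡⟨ cong suc (+-identityʳ R) ⟩
    suc R            ≡⟨ +-comm 1 R ⟩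
    R + 1            ∎
    where
    L U R : ℕ
    L = length (wt (step f q))
    U = upSteps (step f q)
    R = rightSteps (step f q)
  length-wt-highway {d = up} e (step {d = up} f q) (() , _)

  length-wt+upSteps≡m : ∀ {w w'} (p : Walk (source w) (sink w')) → Highway p →
                        length (wt p) + upSteps p ≡ m
  length-wt+upSteps≡m p@(step e@(enter _ _ _) q) h =
    suc-injective (trans (length-wt-highway e q h) (rightSteps+column≡suc-m p))

IsAbove⇒suc≡[mod] : ∀ {n} .{{_ : NonZero n}} {v w : Fin n} → IsAbove v w → toℕ v + 1 ≡ toℕ w [mod n ]
IsAbove⇒suc≡[mod] {n} (inj₁ 1+v≡w) = cong (_% n) (trans (+-comm _ 1) 1+v≡w)
IsAbove⇒suc≡[mod] {n} {v} {w} (inj₂ (w≡0 , 1+v≡n)) = begin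
  (toℕ v + 1) % n  ≡⟨ cong (_% n) (trans (+-comm _ 1) 1+v≡n) ⟩
  n % n            ≡⟨ n%n≡0 n ⟩
  0                ≡⟨ m*n%n≡0 0 n ⟨
  0 % n            ≡⟨ cong (_% n) w≡0 ⟨
  toℕ w % n        ∎

sinkWire+upSteps≡wire : ∀ {n m} .{{_ : NonZero n}} {x : Vertex n m} {w' : Fin n} (p : Walk x (sink w')) →
                        toℕ w' + upSteps p ≡ wire x [mod n ]
sinkWire+upSteps≡wire {n} [] = cong (_% n) (+-identityʳ _)
sinkWire+upSteps≡wire (step (enter _ _ _) p)   = sinkWire+upSteps≡wire p
sinkWire+upSteps≡wire (step (along _ _ _ _) p) = sinkWire+upSteps≡wire p
sinkWire+upSteps≡wire (step (exit _ _ _) p)    = sinkWire+upSteps≡wire p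
sinkWire+upSteps≡wire {n} {w' = w'} (step (climb w v _ v-above-w) p) = begin
  (toℕ w' + suc (upSteps p)) % n  ≡⟨ cong (_% n) (trans (+-suc (toℕ w') _) (+-comm 1 _)) ⟩
  (toℕ w' + upSteps p + 1) % n    ≡⟨ +-congʳ-mod n 1 (sinkWire+upSteps≡wire p) ⟩
  (toℕ v + 1) % n                 ≡⟨ IsAbove⇒suc≡[mod] v-above-w ⟩
  toℕ w % n                       ∎

deg-highway : ∀ {n m} .{{_ : NonZero n}} {w w' : Fin n} (p : Walk {n} {m} (source w) (sink w')) →
              Highway p → length (wt p) + toℕ w ≡ m + toℕ w' [mod n ]
deg-highway {n} {m} {w} {w'} p h = begin
  (L + toℕ w) % n                ≡⟨ +-cong-mod n {L} refl (sinkWire+upSteps≡wire p) ⟨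
  (L + (toℕ w' + upSteps p)) % n ≡⟨ cong (λ t → (L + t) % n) (+-comm (toℕ w') (upSteps p)) ⟩
  (L + (upSteps p + toℕ w')) % n ≡⟨ cong (_% n) (+-assoc L (upSteps p) (toℕ w')) ⟨
  (L + upSteps p + toℕ w') % n   ≡⟨ cong (λ t → (t + toℕ w') % n) (length-wt+upSteps≡m p h) ⟩
  (m + toℕ w') % n               ∎
  where
  L : ℕ
  L = length (wt p)

deg+sources≡[mod] : ∀ {n m k} .{{_ : NonZero n}} {s r : Fin k → Fin n} (F : Family n m k s r) →
                    deg F + sum (λ i → toℕ (s i)) ≡ sum (λ (_ : Fin k) → m) + sum (λ i → toℕ (r i)) [mod n ]
deg+sources≡[mod] {n} {m} {k} {s} {r} F = begin
  (deg F + Σs) % n                      ≡⟨ cong (λ t → (t + Σs) % n) (length-concat-tabulate (λ i → wt (path i))) ⟩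
  (sum (λ i → length (wt (path i))) + Σs) % n
                                        ≡⟨ cong (_% n) (∑-distrib-+ (λ i → length (wt (path i))) (λ i → toℕ (s i))) ⟨
  sum (λ i → length (wt (path i)) + toℕ (s i)) % n
                                        ≡⟨ sum-cong-mod n _ _ (λ i → deg-highway (path i) (highway i)) ⟩
  sum (λ i → m + toℕ (r (π ⟨$⟩ʳ i))) % n ≡⟨ cong (_% n) (∑-distrib-+ (λ _ → m) (λ i → toℕ (r (π ⟨$⟩ʳ i)))) ⟩
  (Σm + sum (λ i → toℕ (r (π ⟨$⟩ʳ i)))) % n
                                        ≡⟨ cong (λ t → (Σm + t) % n) (sum-permute (λ i → toℕ (r i)) π) ⟨
  (Σm + sum (λ i → toℕ (r i))) % n      ∎
  where
  open Family F renaming (pairing to π)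
  Σs Σm : ℕ
  Σs = sum (λ i → toℕ (s i))
  Σm = sum (λ (_ : Fin k) → m)

mainTheorem10 : (n m : ℕ) → .{{_ : NonZero n}} → 2 ≤ n → 1 ≤ m →
                (k : ℕ) (s r : Fin k → Fin n) →
                Injective _≡_ _≡_ s → Injective _≡_ _≡_ r →
                (P Q : Family n m k s r) →
                deg P % n ≡ deg Q % n
mainTheorem10 n m _ _ k s r _ _ P Q =
  +-cancelʳ-mod n (deg P) (deg Q) (sum (λ i → toℕ (s i)))
    (trans (deg+sources≡[mod] P) (sym (deg+sources≡[mod] Q)))
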